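{- Let $t$ be an arbor on a finite set $I$. Every point of the Minkowski sum $\mathbb{M}_t=\sum_{v} U_v$ (sum over all vertices $v$ of $t$) satisfies all the defining inequalities of $Q_t$; that is, $\mathbb{M}_t\subseteq Q_t$.
   Context: An arbor on a finite non-empty set $I$ is a rooted tree whose vertices are labeled by pairwise disjoint non-empty subsets of $I$ whose union is $I$; we identify a vertex with its label set and write $|v|$ for its cardinality. For a vertex $v$, $\mathscr{D}(v)\subseteq I$ is the union of the labels of all vertices $w$ whose path to the root passes through $v$ (including $v$), and $\mathscr{U}(v)\subseteq I$ is the union of the labels of all vertices on the path from the root to $v$ (both included). The polytope $Q_t\subset \mathbb{R}^I$ is defined by $x_i\ge 0$ for all $i\in I$ and $\sum_{i\in\mathscr{D}(v)}x_i\le|\mathscr{D}(v)|$ for every vertex $v$. For a vertex $v$, $U_v\subset\mathbb{R}^I$ is the simplex equal to the convex hull of the origin and the points $|v|e_i$ for $i\in\mathscr{U}(v)$, where $(e_i)_{i\in I}$ is the standard basis.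
   Formalization: Points of $\mathbb{M}_t$ and $Q_t$ have rational rather than real coordinates, and the convex coefficients describing points of each simplex $U_v$ are rational. -}

module Defs where

open import Data.Nat using (ℕ)
open import Data.Fin using (Fin)
open import Data.List using (List; []; _∷_; _++_; map; foldr; length; allFin)
open import Data.List.Membership.Propositional using (_∈_)
open import Data.List.Relation.Unary.All using (All)
open import Data.List.Relation.Binary.Permutation.Propositional using (_↭_)
open import Data.List.Relation.Unary.Any using (Any)
open import Data.Product using (Σ; _×_; _,_; proj₁; proj₂)
open import Data.Integer using (+_)
open import Data.Rational using (ℚ; 0ℚ; 1ℚ; _+_; _*_; _≤_; _/_)
open import Relation.Binary.PropositionalEquality using (_≡_)
open import Relation.Nullary using (¬_)

-- The ground set I is Fin n.  An arbor is a rooted (rose) tree whose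
-- vertices carry labels, given as lists of elements of Fin n.
data Tree (n : ℕ) : Set where
  node : List (Fin n) → List (Tree n) → Tree n

-- all labels of a tree, concatenated (= 𝒟 of the root)
mutual
  flatten : ∀ {n} → Tree n → List (Fin n)
  flatten (node ℓ ts) = ℓ ++ flattenF ts

  flattenF : ∀ {n} → List (Tree n) → List (Fin n)
  flattenF []       = []
  flattenF (t ∷ ts) = flatten t ++ flattenF ts

-- Data attached to a vertex v: its label v, 𝒟(v), 𝒰(v).
record VInfo (n : ℕ) : Set where
  constructor vinfo
  field
    label : List (Fin n)
    down  : List (Fin n)
    up    : List (Fin n)
open VInfo public

-- All vertices of a tree; the argument is the union of labels of strict ancestors.
mutual
  verticesFrom : ∀ {n} → List (Fin n) → Tree n → List (VInfo n)
  verticesFrom anc (node ℓ ts) =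
    vinfo ℓ (flatten (node ℓ ts)) (anc ++ ℓ) ∷ verticesFromF (anc ++ ℓ) ts

  verticesFromF : ∀ {n} → List (Fin n) → List (Tree n) → List (VInfo n)
  verticesFromF anc []       = []
  verticesFromF anc (t ∷ ts) = verticesFrom anc t ++ verticesFromF anc ts

vertices : ∀ {n} → Tree n → List (VInfo n)
vertices = verticesFrom []

data NonEmpty {A : Set} : List A → Set where
  nonEmpty : ∀ x xs → NonEmpty (x ∷ xs)

-- An arbor on Fin n: labels non-empty, pairwise disjoint and covering
-- (the concatenation of all labels is a permutation of Fin n).
record IsArbor {n : ℕ} (t : Tree n) : Set where
  field
    labels-nonempty : All (λ v → NonEmpty (label v)) (vertices t)
    partition       : flatten t ↭ allFin n

Point : ℕ → Set
Point n = Fin n → ℚ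

sumℚ : List ℚ → ℚ
sumℚ = foldr _+_ 0ℚ

ℕtoℚ : ℕ → ℚ
ℕtoℚ k = (+ k) / 1

-- y ∈ U_v : y is a convex combination of the origin and the points |v| e_i,
-- i ∈ 𝒰(v), i.e. y = Σ_{i∈𝒰(v)} λ_i |v| e_i with λ_i ≥ 0, Σ λ_i ≤ 1
-- (the coefficient of the origin being 1 - Σ λ_i).
InU : ∀ {n} → VInfo n → Point n → Set
InU {n} v y =
  Σ (Point n) λ lam →
    (∀ i → 0ℚ ≤ lam i) ×
    (∀ i → ¬ (i ∈ up v) → lam i ≡ 0ℚ) ×
    (sumℚ (map lam (allFin n)) ≤ 1ℚ) ×
    (∀ i → y i ≡ lam i * ℕtoℚ (length (label v)))

InMinkowski : ∀ {n} → Tree n → Point n → Set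
InMinkowski {n} t x =
  Σ (Fin (length (vertices t)) → Point n) λ ys →
    (∀ k → InU (Data.List.lookup (vertices t) k) (ys k)) ×
    (∀ i → x i ≡ sumℚ (map (λ k → ys k i) (allFin (length (vertices t)))))

InQ : ∀ {n} → Tree n → Point n → Set
InQ {n} t x =
  (∀ i → 0ℚ ≤ x i) ×
  All (λ v → sumℚ (map x (down v)) ≤ ℕtoℚ (length (down v))) (vertices t)

module Submission where

-- Fix a vertex v and let D = 𝒟(v). A point y = |w| Σ λ_i e_i of U_w contributes
-- |w| Σ_{i∈D} λ_i ≤ |w| to Σ_{i∈D} y_i, as D lists distinct elements of I. If w is not
-- below v, no vertex on the path from the root to w is below v, so 𝒰(w) misses D and the
-- contribution is 0. Either way it is at most |w ∩ D|, and these bounds add up to |D|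
-- because the labels partition I.

open import Defs
open import Data.Nat using (ℕ)
import Data.Nat as ℕ
import Data.Nat.Properties as ℕ
open import Data.Nat.ListAction using (sum)
open import Data.Fin using (Fin)
open import Data.Fin.Properties using (_≟_)
open import Data.List
  using (List; []; _∷_; _++_; map; length; allFin; lookup; tabulate; concatMap; filter)
open import Data.List.Properties
  using (map-cong; map-++; ++-assoc; ++-identityʳ; concatMap-++; filter-++; length-++;
         filter-all; filter-none; map-tabulate; tabulate-lookup)
open import Data.List.Membership.Propositional using (_∈_)
import Data.List.Membership.DecPropositional as DecMembership
open import Data.List.Membership.Propositional.Properties
  using (∈-++⁻; ∈-lookup; ∈-map⁺; ∈-concat⁺′)
open import Data.List.Relation.Binary.Subset.Propositional using (_⊆_)
open import Data.List.Relation.Binary.Subset.Propositional.Properties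
  using (⊆-refl; ⊆-trans; ⊆-reflexive; xs⊆xs++ys; xs⊆ys++xs)
  renaming (++⁺ʳ to ⊆-++⁺ʳ)
open import Data.List.Relation.Binary.Disjoint.Propositional using (Disjoint)
import Data.List.Relation.Binary.Disjoint.Propositional.Properties as Disjoint
open import Data.List.Relation.Unary.All as All using (All; []; _∷_)
import Data.List.Relation.Unary.All.Properties as All
open import Data.List.Relation.Unary.Any using (here; there)
open import Data.List.Relation.Unary.AllPairs using (_∷_)
open import Data.List.Relation.Unary.Unique.Propositional using (Unique)
open import Data.List.Relation.Unary.Unique.Propositional.Properties using (allFin⁺)
open import Data.List.Relation.Binary.Permutation.Propositional
  using (_↭_; ↭-sym; ↭-trans; ↭-reflexive; ↭⇒↭ₛ)
open import Data.List.Relation.Binary.Permutation.Propositional.Properties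
  using (shifts; filter-↭; ↭-length)
  renaming (map⁺ to ↭-map⁺; ++⁺ˡ to ↭-++⁺ˡ; ++⁺ʳ to ↭-++⁺ʳ)
import Data.List.Relation.Binary.Permutation.Setoid.Properties as Permutationₛ
open import Data.Product using (Σ-syntax; _×_; _,_)
open import Data.Sum using (_⊎_; inj₁; inj₂)
import Data.Integer as ℤ
import Data.Integer.Properties as ℤ
import Data.Nat.Coprimality as Coprimality
open import Data.Rational using (ℚ; NonNegative; 0ℚ; 1ℚ; _+_; _*_; _≤_; _/_; mkℚ)
open import Data.Rational.Properties
  using (+-identityˡ; +-identityʳ; +-assoc; *-zeroˡ; *-identityˡ; *-distribʳ-+;
         ≤-refl; +-mono-≤; +-monoʳ-≤; ≤-trans; *-monoʳ-≤-nonNeg; nonNegative⁻¹;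
         normalize-coprime; normalize-nonNeg;
         +-0-isCommutativeMonoid; +-0-commutativeMonoid; module ≤-Reasoning)
open import Algebra.Bundles using (CommutativeMonoid)
open import Algebra.Properties.CommutativeSemigroup
  (CommutativeMonoid.commutativeSemigroup +-0-commutativeMonoid) using (interchange)
open import Function using (_∘_)
open import Relation.Nullary using (Dec)
open import Relation.Binary.PropositionalEquality
  using (_≡_; refl; sym; trans; cong; cong₂; subst; setoid; module ≡-Reasoning)

private
  variable
    A B : Set
    n : ℕ

ℕtoℚ-nonNeg : ∀ k → NonNegative (ℕtoℚ k)
ℕtoℚ-nonNeg k = normalize-nonNeg k 1

ℕtoℚ≡mkℚ : ∀ k → ℕtoℚ k ≡ mkℚ (ℤ.+ k) 0 (Coprimality.sym (Coprimality.1-coprimeTo k))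
ℕtoℚ≡mkℚ k = normalize-coprime (Coprimality.sym (Coprimality.1-coprimeTo k))

ℕtoℚ-+ : ∀ a b → ℕtoℚ (a ℕ.+ b) ≡ ℕtoℚ a + ℕtoℚ b
-- Once both summands are in normal form, their sum computes to (a * 1 + b * 1) / 1.
ℕtoℚ-+ a b rewrite ℕtoℚ≡mkℚ a | ℕtoℚ≡mkℚ b =
  cong (_/ 1) (sym (cong₂ ℤ._+_ (ℤ.*-identityʳ (ℤ.+ a)) (ℤ.*-identityʳ (ℤ.+ b))))

sumℚ-++ : (ps qs : List ℚ) → sumℚ (ps ++ qs) ≡ sumℚ ps + sumℚ qs
sumℚ-++ []       qs = sym (+-identityˡ (sumℚ qs))
sumℚ-++ (p ∷ ps) qs = trans (cong (p +_) (sumℚ-++ ps qs)) (sym (+-assoc p (sumℚ ps) (sumℚ qs)))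

sumℚ-↭ : {ps qs : List ℚ} → ps ↭ qs → sumℚ ps ≡ sumℚ qs
sumℚ-↭ = Permutationₛ.foldr-commMonoid (setoid ℚ) +-0-isCommutativeMonoid ∘ ↭⇒↭ₛ

sumℚ-map-zero : {f : A → ℚ} {xs : List A} → All (λ a → f a ≡ 0ℚ) xs → sumℚ (map f xs) ≡ 0ℚ
sumℚ-map-zero []           = refl
sumℚ-map-zero (fx≡0 ∷ fxs≡0) = trans (cong₂ _+_ fx≡0 (sumℚ-map-zero fxs≡0)) (+-identityˡ 0ℚ)

sumℚ-map-mono-≤ : {f g : A → ℚ} → (∀ a → f a ≤ g a) → ∀ xs → sumℚ (map f xs) ≤ sumℚ (map g xs)
sumℚ-map-mono-≤ f≤g []       = ≤-refl
sumℚ-map-mono-≤ f≤g (x ∷ xs) = +-mono-≤ (f≤g x) (sumℚ-map-mono-≤ f≤g xs)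

sumℚ-map-nonNeg : {f : A → ℚ} → (∀ a → 0ℚ ≤ f a) → ∀ xs → 0ℚ ≤ sumℚ (map f xs)
sumℚ-map-nonNeg {f = f} 0≤f xs =
  subst (_≤ sumℚ (map f xs)) (sumℚ-map-zero (All.universal (λ _ → refl) xs)) (sumℚ-map-mono-≤ 0≤f xs)

sumℚ-map-+ : (f g : A → ℚ) (xs : List A) →
             sumℚ (map (λ a → f a + g a) xs) ≡ sumℚ (map f xs) + sumℚ (map g xs)
sumℚ-map-+ f g []       = refl
sumℚ-map-+ f g (x ∷ xs) =
  trans (cong (f x + g x +_) (sumℚ-map-+ f g xs)) (interchange (f x) (g x) _ _)

sumℚ-map-*ʳ : (f : A → ℚ) (c : ℚ) (xs : List A) →
              sumℚ (map (λ a → f a * c) xs) ≡ sumℚ (map f xs) * c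
sumℚ-map-*ʳ f c []       = sym (*-zeroˡ c)
sumℚ-map-*ʳ f c (x ∷ xs) =
  trans (cong (f x * c +_) (sumℚ-map-*ʳ f c xs)) (sym (*-distribʳ-+ c (f x) (sumℚ (map f xs))))

sumℚ-map-comm : (f : A → B → ℚ) (xs : List A) (ys : List B) →
                sumℚ (map (λ a → sumℚ (map (f a) ys)) xs) ≡
                sumℚ (map (λ b → sumℚ (map (λ a → f a b) xs)) ys)
sumℚ-map-comm f []       ys = sym (sumℚ-map-zero (All.universal (λ _ → refl) ys))
sumℚ-map-comm f (x ∷ xs) ys =
  trans (cong (sumℚ (map (f x) ys) +_) (sumℚ-map-comm f xs ys))
        (sym (sumℚ-map-+ (f x) (λ b → sumℚ (map (λ a → f a b) xs)) ys))

sumℚ-map-≤-↭ : {f : A → ℚ} → (∀ a → 0ℚ ≤ f a) → (xs ys : List A) {zs : List A} → xs ++ ys ↭ zs →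
               sumℚ (map f xs) ≤ sumℚ (map f zs)
sumℚ-map-≤-↭ {f = f} 0≤f xs ys {zs} xs++ys↭zs = begin
  sumℚ (map f xs)                     ≡⟨ sym (+-identityʳ _) ⟩
  sumℚ (map f xs) + 0ℚ                ≤⟨ +-monoʳ-≤ (sumℚ (map f xs)) (sumℚ-map-nonNeg 0≤f ys) ⟩
  sumℚ (map f xs) + sumℚ (map f ys)   ≡⟨ sym (sumℚ-++ (map f xs) (map f ys)) ⟩
  sumℚ (map f xs ++ map f ys)         ≡⟨ cong sumℚ (sym (map-++ f xs ys)) ⟩
  sumℚ (map f (xs ++ ys))             ≡⟨ sumℚ-↭ (↭-map⁺ f xs++ys↭zs) ⟩
  sumℚ (map f zs)                     ∎
  where open ≤-Reasoning

map-lookup-allFin : (f : A → B) (xs : List A) → map (f ∘ lookup xs) (allFin (length xs)) ≡ map f xs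
map-lookup-allFin f xs = begin
  map (f ∘ lookup xs) (allFin (length xs)) ≡⟨ map-tabulate (λ k → k) (f ∘ lookup xs) ⟩
  tabulate (f ∘ lookup xs)                 ≡⟨ sym (map-tabulate (lookup xs) f) ⟩
  map f (tabulate (lookup xs))             ≡⟨ cong (map f) (tabulate-lookup xs) ⟩
  map f xs                                 ∎
  where open ≡-Reasoning

sumℚ-map-ℕtoℚ : (g : A → ℕ) (xs : List A) → sumℚ (map (ℕtoℚ ∘ g) xs) ≡ ℕtoℚ (sum (map g xs))
sumℚ-map-ℕtoℚ g []       = refl
sumℚ-map-ℕtoℚ g (x ∷ xs) =
  trans (cong (ℕtoℚ (g x) +_) (sumℚ-map-ℕtoℚ g xs)) (sym (ℕtoℚ-+ (g x) (sum (map g xs))))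

Unique-++⇒Disjoint : (xs : List A) {ys : List A} → Unique (xs ++ ys) → Disjoint xs ys
Unique-++⇒Disjoint (x ∷ xs) (x∉xs++ys ∷ _) (here refl , v∈ys) =
  All.lookup (All.++⁻ʳ xs x∉xs++ys) v∈ys refl
Unique-++⇒Disjoint (x ∷ xs) (_ ∷ unique) (there v∈xs , v∈ys) =
  Unique-++⇒Disjoint xs unique (v∈xs , v∈ys)

++-↭-allFin⇒Disjoint : (xs : List (Fin n)) {ys : List (Fin n)} → xs ++ ys ↭ allFin n → Disjoint xs ys
++-↭-allFin⇒Disjoint xs xs++ys↭ =
  Unique-++⇒Disjoint xs (Permutationₛ.Unique-resp-↭ (setoid _) (↭⇒↭ₛ (↭-sym xs++ys↭)) (allFin⁺ _))

_∈?_ : (i : Fin n) (D : List (Fin n)) → Dec (i ∈ D)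
_∈?_ = DecMembership._∈?_ _≟_

countIn : List (Fin n) → List (Fin n) → ℕ
countIn D = length ∘ filter (_∈? D)

countIn-++ : (D xs ys : List (Fin n)) → countIn D (xs ++ ys) ≡ countIn D xs ℕ.+ countIn D ys
countIn-++ D xs ys =
  trans (cong length (filter-++ (_∈? D) xs ys)) (length-++ (filter (_∈? D) xs))

countIn-↭ : (D : List (Fin n)) {xs ys : List (Fin n)} → xs ↭ ys → countIn D xs ≡ countIn D ys
countIn-↭ D = ↭-length ∘ filter-↭ (_∈? D)

countIn-⊆ : (D : List (Fin n)) {xs : List (Fin n)} → xs ⊆ D → countIn D xs ≡ length xs
countIn-⊆ D xs⊆D = cong length (filter-all (_∈? D) (All.tabulate xs⊆D))

countIn-disjoint : (D : List (Fin n)) {xs : List (Fin n)} → Disjoint xs D → countIn D xs ≡ 0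
countIn-disjoint D xs#D =
  cong length (filter-none (_∈? D) (All.tabulate (λ i∈xs i∈D → xs#D (i∈xs , i∈D))))

sum-countIn-concatMap : (D : List (Fin n)) (f : A → List (Fin n)) (xs : List A) →
                        sum (map (countIn D ∘ f) xs) ≡ countIn D (concatMap f xs)
sum-countIn-concatMap D f []       = refl
sum-countIn-concatMap D f (x ∷ xs) =
  trans (cong (countIn D (f x) ℕ.+_) (sum-countIn-concatMap D f xs))
        (sym (countIn-++ D (f x) (concatMap f xs)))

mutual
  concatMap-label-verticesFrom : (anc : List (Fin n)) (t : Tree n) →
                                 concatMap label (verticesFrom anc t) ≡ flatten t
  concatMap-label-verticesFrom anc (node ℓ ts) =
    cong (ℓ ++_) (concatMap-label-verticesFromF (anc ++ ℓ) ts)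

  concatMap-label-verticesFromF : (anc : List (Fin n)) (ts : List (Tree n)) →
                                  concatMap label (verticesFromF anc ts) ≡ flattenF ts
  concatMap-label-verticesFromF anc []       = refl
  concatMap-label-verticesFromF anc (t ∷ ts) =
    trans (concatMap-++ label (verticesFrom anc t) (verticesFromF anc ts))
          (cong₂ _++_ (concatMap-label-verticesFrom anc t) (concatMap-label-verticesFromF anc ts))

label⊆flatten : (anc : List (Fin n)) (t : Tree n) {w : VInfo n} →
                w ∈ verticesFrom anc t → label w ⊆ flatten t
label⊆flatten anc t w∈ i∈ =
  subst (_ ∈_) (concatMap-label-verticesFrom anc t) (∈-concat⁺′ i∈ (∈-map⁺ label w∈))

mutual
  up⊆anc++flatten : (anc : List (Fin n)) (t : Tree n) {w : VInfo n} →
                    w ∈ verticesFrom anc t → up w ⊆ anc ++ flatten t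
  up⊆anc++flatten anc (node ℓ ts) (here refl) = ⊆-++⁺ʳ anc (xs⊆xs++ys ℓ (flattenF ts))
  up⊆anc++flatten anc (node ℓ ts) (there w∈) =
    ⊆-trans (up⊆anc++flattenF (anc ++ ℓ) ts w∈) (⊆-reflexive (++-assoc anc ℓ (flattenF ts)))

  up⊆anc++flattenF : (anc : List (Fin n)) (ts : List (Tree n)) {w : VInfo n} →
                     w ∈ verticesFromF anc ts → up w ⊆ anc ++ flattenF ts
  up⊆anc++flattenF anc (t ∷ ts) w∈ with ∈-++⁻ (verticesFrom anc t) w∈
  ... | inj₁ w∈t  = ⊆-trans (up⊆anc++flatten anc t w∈t) (⊆-++⁺ʳ anc (xs⊆xs++ys (flatten t) _))
  ... | inj₂ w∈ts = ⊆-trans (up⊆anc++flattenF anc ts w∈ts) (⊆-++⁺ʳ anc (xs⊆ys++xs _ (flatten t)))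

-- With D = 𝒟(v): w lies below v, or its root path stays inside U.
BelowOrAvoiding : (D U : List (Fin n)) → VInfo n → Set
BelowOrAvoiding D U w = label w ⊆ D ⊎ up w ⊆ U

BelowOrAvoiding-mono : {D U U′ : List (Fin n)} {ws : List (VInfo n)} → U ⊆ U′ →
                       All (BelowOrAvoiding D U) ws → All (BelowOrAvoiding D U′) ws
BelowOrAvoiding-mono U⊆U′ = All.map λ where
  (inj₁ below)  → inj₁ below
  (inj₂ avoids) → inj₂ (⊆-trans avoids U⊆U′)

-- R collects the labels outside the subtree at v.
mutual
  down-complement : (anc : List (Fin n)) (t : Tree n) {v : VInfo n} → v ∈ verticesFrom anc t →
    Σ[ R ∈ List (Fin n) ] flatten t ↭ down v ++ R ×
      All (BelowOrAvoiding (down v) (anc ++ R)) (verticesFrom anc t)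
  down-complement anc t@(node ℓ ts) (here refl) =
    [] , ↭-reflexive (sym (++-identityʳ (flatten t))) , All.tabulate (inj₁ ∘ label⊆flatten anc t)
  down-complement anc (node ℓ ts) {v} (there v∈) with down-complement-F (anc ++ ℓ) ts v∈
  ... | R , flatten↭ , below-or-avoiding =
    ℓ ++ R ,
    ↭-trans (↭-++⁺ˡ ℓ flatten↭) (shifts ℓ (down v)) ,
    inj₂ (⊆-++⁺ʳ anc (xs⊆xs++ys ℓ R)) ∷
      BelowOrAvoiding-mono (⊆-reflexive (++-assoc anc ℓ R)) below-or-avoiding

  down-complement-F : (anc : List (Fin n)) (ts : List (Tree n)) {v : VInfo n} →
    v ∈ verticesFromF anc ts →
    Σ[ R ∈ List (Fin n) ] flattenF ts ↭ down v ++ R ×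
      All (BelowOrAvoiding (down v) (anc ++ R)) (verticesFromF anc ts)
  down-complement-F anc (t ∷ ts) {v} v∈ with ∈-++⁻ (verticesFrom anc t) v∈
  ... | inj₁ v∈t with down-complement anc t v∈t
  ...   | R , flatten↭ , below-or-avoiding =
    R ++ flattenF ts ,
    ↭-trans (↭-++⁺ʳ (flattenF ts) flatten↭) (↭-reflexive (++-assoc (down v) R (flattenF ts))) ,
    All.++⁺
      (BelowOrAvoiding-mono (⊆-++⁺ʳ anc (xs⊆xs++ys R (flattenF ts))) below-or-avoiding)
      (All.tabulate (λ w∈ts → inj₂ (⊆-trans (up⊆anc++flattenF anc ts w∈ts)
                                            (⊆-++⁺ʳ anc (xs⊆ys++xs (flattenF ts) R)))))
  down-complement-F anc (t ∷ ts) {v} v∈ | inj₂ v∈ts with down-complement-F anc ts v∈ts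
  ...   | R , flatten↭ , below-or-avoiding =
    flatten t ++ R ,
    ↭-trans (↭-++⁺ˡ (flatten t) flatten↭) (shifts (flatten t) (down v)) ,
    All.++⁺
      (All.tabulate (λ w∈t → inj₂ (⊆-trans (up⊆anc++flatten anc t w∈t)
                                           (⊆-++⁺ʳ anc (xs⊆xs++ys (flatten t) R)))))
      (BelowOrAvoiding-mono (⊆-++⁺ʳ anc (xs⊆ys++xs R (flatten t))) below-or-avoiding)

sum-countIn-labels : (anc : List (Fin n)) (t : Tree n) {D R : List (Fin n)} →
                     flatten t ↭ D ++ R → Disjoint D R →
                     sum (map (countIn D ∘ label) (verticesFrom anc t)) ≡ length D
sum-countIn-labels anc t {D} {R} flatten↭ D#R = begin
  sum (map (countIn D ∘ label) vs)   ≡⟨ sum-countIn-concatMap D label vs ⟩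
  countIn D (concatMap label vs)     ≡⟨ cong (countIn D) (concatMap-label-verticesFrom anc t) ⟩
  countIn D (flatten t)              ≡⟨ countIn-↭ D flatten↭ ⟩
  countIn D (D ++ R)                 ≡⟨ countIn-++ D D R ⟩
  countIn D D ℕ.+ countIn D R        ≡⟨ cong₂ ℕ._+_ (countIn-⊆ D ⊆-refl)
                                                    (countIn-disjoint D (Disjoint.sym D#R)) ⟩
  length D ℕ.+ 0                     ≡⟨ ℕ.+-identityʳ (length D) ⟩
  length D                           ∎
  where
  open ≡-Reasoning
  vs = verticesFrom anc t

InU-nonNeg : (w : VInfo n) {y : Point n} → InU w y → ∀ i → 0ℚ ≤ y i
InU-nonNeg w {y} (lam , 0≤lam , _ , _ , y≡lam*|w|) i = begin
  0ℚ          ≡⟨ sym (*-zeroˡ |w|) ⟩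
  0ℚ * |w|    ≤⟨ *-monoʳ-≤-nonNeg |w| {{ℕtoℚ-nonNeg (length (label w))}} (0≤lam i) ⟩
  lam i * |w| ≡⟨ sym (y≡lam*|w| i) ⟩
  y i         ∎
  where
  open ≤-Reasoning
  |w| = ℕtoℚ (length (label w))

InU-sum-≤ : (D R : List (Fin n)) → D ++ R ↭ allFin n → (w : VInfo n) {y : Point n} → InU w y →
            sumℚ (map y D) ≤ ℕtoℚ (length (label w))
InU-sum-≤ D R D++R↭ w {y} (lam , 0≤lam , _ , Σlam≤1 , y≡lam*|w|) = begin
  sumℚ (map y D)                   ≡⟨ cong sumℚ (map-cong y≡lam*|w| D) ⟩
  sumℚ (map (λ i → lam i * |w|) D) ≡⟨ sumℚ-map-*ʳ lam |w| D ⟩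
  sumℚ (map lam D) * |w|           ≤⟨ *-monoʳ-≤-nonNeg |w| {{ℕtoℚ-nonNeg (length (label w))}} ΣDlam≤1 ⟩
  1ℚ * |w|                         ≡⟨ *-identityˡ |w| ⟩
  |w|                              ∎
  where
  open ≤-Reasoning
  |w| = ℕtoℚ (length (label w))
  ΣDlam≤1 : sumℚ (map lam D) ≤ 1ℚ
  ΣDlam≤1 = ≤-trans (sumℚ-map-≤-↭ 0≤lam D R D++R↭) Σlam≤1

InU-sum-≡0 : (D : List (Fin n)) (w : VInfo n) {y : Point n} → Disjoint (up w) D → InU w y →
             sumℚ (map y D) ≡ 0ℚ
InU-sum-≡0 D w {y} up#D (lam , _ , lam≡0 , _ , y≡lam*|w|) =
  trans (cong sumℚ (map-cong y≡lam*|w| D)) (sumℚ-map-zero (All.tabulate summand≡0))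
  where
  |w| = ℕtoℚ (length (label w))
  summand≡0 : ∀ {i} → i ∈ D → lam i * |w| ≡ 0ℚ
  summand≡0 {i} i∈D = trans (cong (_* |w|) (lam≡0 i (λ i∈up → up#D (i∈up , i∈D)))) (*-zeroˡ |w|)

InU-sum-≤-countIn : (D R : List (Fin n)) → D ++ R ↭ allFin n → Disjoint D R →
                    (w : VInfo n) {y : Point n} → InU w y → BelowOrAvoiding D R w →
                    sumℚ (map y D) ≤ ℕtoℚ (countIn D (label w))
InU-sum-≤-countIn D R D++R↭ D#R w {y} y∈U (inj₁ below) =
  subst (sumℚ (map y D) ≤_) (cong ℕtoℚ (sym (countIn-⊆ D below))) (InU-sum-≤ D R D++R↭ w y∈U)
InU-sum-≤-countIn D R D++R↭ D#R w y∈U (inj₂ avoids) =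
  subst (_≤ ℕtoℚ (countIn D (label w)))
        (sym (InU-sum-≡0 D w (λ (i∈up , i∈D) → D#R (i∈D , avoids i∈up)) y∈U))
        (nonNegative⁻¹ _ {{ℕtoℚ-nonNeg (countIn D (label w))}})

lemma1p6 : (n : ℕ) (t : Tree n) → IsArbor t →
    (x : Point n) → InMinkowski t x → InQ t x
lemma1p6 n t arbor x (ys , ys∈U , x≡Σys) = x-nonNeg , All.tabulate bound
  where
  vs = vertices t
  ks = allFin (length vs)

  x-nonNeg : ∀ i → 0ℚ ≤ x i
  x-nonNeg i =
    subst (0ℚ ≤_) (sym (x≡Σys i)) (sumℚ-map-nonNeg (λ k → InU-nonNeg (lookup vs k) (ys∈U k) i) ks)

  bound : ∀ {v} → v ∈ vs → sumℚ (map x (down v)) ≤ ℕtoℚ (length (down v))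
  bound {v} v∈vs with down-complement [] t v∈vs
  ... | R , flatten↭ , below-or-avoiding = begin
    sumℚ (map x D)                                    ≡⟨ cong sumℚ (map-cong x≡Σys D) ⟩
    sumℚ (map (λ i → sumℚ (map (λ k → ys k i) ks)) D) ≡⟨ sumℚ-map-comm (λ i k → ys k i) D ks ⟩
    sumℚ (map (λ k → sumℚ (map (ys k) D)) ks)         ≤⟨ sumℚ-map-mono-≤ summand-bound ks ⟩
    sumℚ (map (ℕtoℚ ∘ c ∘ lookup vs) ks)              ≡⟨ cong sumℚ (map-lookup-allFin (ℕtoℚ ∘ c) vs) ⟩
    sumℚ (map (ℕtoℚ ∘ c) vs)                          ≡⟨ sumℚ-map-ℕtoℚ c vs ⟩
    ℕtoℚ (sum (map c vs))                             ≡⟨ cong ℕtoℚ (sum-countIn-labels [] t flatten↭ D#R) ⟩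
    ℕtoℚ (length D)                                   ∎
    where
    open ≤-Reasoning
    D = down v
    c = countIn D ∘ label
    D++R↭I : D ++ R ↭ allFin n
    D++R↭I = ↭-trans (↭-sym flatten↭) (IsArbor.partition arbor)
    D#R : Disjoint D R
    D#R = ++-↭-allFin⇒Disjoint D D++R↭I
    summand-bound : ∀ k → sumℚ (map (ys k) D) ≤ ℕtoℚ (c (lookup vs k))
    summand-bound k = InU-sum-≤-countIn D R D++R↭I D#R (lookup vs k) (ys∈U k)
                        (All.lookup below-or-avoiding (∈-lookup k))
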